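{- There is a left-linear monadic TRS $R$ over a ranked alphabet $\Sigma$ such that $R$ is an EP$\Sigma$RF-TRS and $R$ is not a P$\Sigma$R-TRS.
   Context: A ranked alphabet $\Sigma$ is a finite set of symbols with ranks; $X$ a countable set of variables, $T_\Sigma(X)$ the terms, $T_\Sigma$ the ground terms; the height of a variable or constant is $0$. A TRS $R$ over $\Sigma$ is a finite set of rules $l\to r$, $l,r\in T_\Sigma(X)$, with every variable of $r$ occurring in $l$; left-linear if no variable occurs twice in a left-hand side; monadic if each left-hand side has height at least $1$ and each right-hand side has height at most $1$. $R^*_\Sigma(L)=\{p\mid q\Rightarrow^*_R p,\ q\in L\}$ for $L\subseteq T_\Sigma$. A bottom-up tree automaton (bta) over $\Sigma$ is a finite automaton with states (treated as constants), final states, rules $\delta(a_1,\dots,a_n)\to a$ and $a\to a'$, recognizing the ground terms rewriting to a final state; recognizable = recognized by some bta. $R$ is a P$\Sigma$R-TRS if $R^*_\Sigma(L)$ is recognizable for every recognizable $L\subseteq T_\Sigma$. $R$ is an EP$\Sigma$RF-TRS if for any given finite $L\subseteq T_\Sigma$ one can effectively construct a bta $\mathcal{C}$ over $\Sigma$ with $L(\mathcal{C})=R^*_\Sigma(L)$. -}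

module Defs where

open import Data.Nat using (ℕ; zero; suc; _≤_; _⊔_)
open import Data.Fin using (Fin)
open import Data.Vec using (Vec; []; _∷_)
open import Data.List using (List; []; _∷_; _++_)
open import Data.List.Membership.Propositional using (_∈_)
open import Data.List.Relation.Unary.All using (All)
open import Data.List.Relation.Unary.Unique.Propositional using (Unique)
open import Data.Product using (Σ; _×_; _,_; ∃)
open import Data.Empty using (⊥)
open import Function.Bundles using (_⇔_)
open import Relation.Nullary using (¬_)
open import Relation.Binary.Construct.Closure.ReflexiveTransitive using (Star)

record RankedAlphabet : Set where
  field
    size : ℕ
    rank : Fin size → ℕ

open RankedAlphabet public

module _ (A : RankedAlphabet) where
  Sym : Set
  Sym = Fin (size A)

data Term (A : RankedAlphabet) (V : Set) : Set where
  var  : V → Term A V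
  node : (f : Fin (size A)) → Vec (Term A V) (rank A f) → Term A V

OTerm : RankedAlphabet → Set
OTerm A = Term A ℕ

GTerm : RankedAlphabet → Set
GTerm A = Term A ⊥

module _ {A : RankedAlphabet} where

  mutual
    subst : {V W : Set} → (V → Term A W) → Term A V → Term A W
    subst σ (var x)     = σ x
    subst σ (node f ts) = node f (substs σ ts)

    substs : {V W : Set} {k : ℕ} → (V → Term A W) → Vec (Term A V) k → Vec (Term A W) k
    substs σ []       = []
    substs σ (t ∷ ts) = subst σ t ∷ substs σ ts

  mutual
    vars : {V : Set} → Term A V → List V
    vars (var x)     = x ∷ []
    vars (node f ts) = varsV ts

    varsV : {V : Set} {k : ℕ} → Vec (Term A V) k → List V
    varsV []       = []
    varsV (t ∷ ts) = vars t ++ varsV ts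

  -- height: variables and constants have height 0;
  -- f(t1..tn) with n ≥ 1 has height 1 + max height of the ti.
  mutual
    height : {V : Set} → Term A V → ℕ
    height (var x)     = 0
    height (node f ts) = nodeHeight ts

    nodeHeight : {V : Set} {k : ℕ} → Vec (Term A V) k → ℕ
    nodeHeight []       = 0
    nodeHeight (t ∷ ts) = suc (maxHeight (t ∷ ts))

    maxHeight : {V : Set} {k : ℕ} → Vec (Term A V) k → ℕ
    maxHeight []       = 0
    maxHeight (t ∷ ts) = height t ⊔ maxHeight ts

  mutual
    data InCtx {V : Set} (ρ : Term A V → Term A V → Set) : Term A V → Term A V → Set where
      root : ∀ {s t} → ρ s t → InCtx ρ s t
      arg  : ∀ {f ts us} → InCtxV ρ ts us → InCtx ρ (node f ts) (node f us)

    data InCtxV {V : Set} (ρ : Term A V → Term A V → Set) : {k : ℕ} → Vec (Term A V) k → Vec (Term A V) k → Set where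
      here  : ∀ {k s t} {ts : Vec (Term A V) k} → InCtx ρ s t → InCtxV ρ (s ∷ ts) (t ∷ ts)
      there : ∀ {k s} {ts us : Vec (Term A V) k} → InCtxV ρ ts us → InCtxV ρ (s ∷ ts) (s ∷ us)

record Rule (A : RankedAlphabet) : Set where
  constructor _⟶_
  field
    lhs : OTerm A
    rhs : OTerm A

open Rule public

record TRS (A : RankedAlphabet) : Set where
  field
    rules  : List (Rule A)
    varCond : All (λ ρ → ∀ x → x ∈ vars (rhs ρ) → x ∈ vars (lhs ρ)) rules

open TRS public

module _ {A : RankedAlphabet} where

  LeftLinear : TRS A → Set
  LeftLinear R = All (λ ρ → Unique (vars (lhs ρ))) (rules R)

  Monadic : TRS A → Set
  Monadic R = All (λ ρ → (1 ≤ height (lhs ρ)) × (height (rhs ρ) ≤ 1)) (rules R)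

  data RootStep (R : TRS A) : GTerm A → GTerm A → Set where
    apply : ∀ {ρ} → ρ ∈ rules R → (σ : ℕ → GTerm A) →
            RootStep R (subst σ (lhs ρ)) (subst σ (rhs ρ))

  _⊢_⇒_ : TRS A → GTerm A → GTerm A → Set
  R ⊢ s ⇒ t = InCtx (RootStep R) s t

  _⊢_⇒*_ : TRS A → GTerm A → GTerm A → Set
  R ⊢ s ⇒* t = Star (R ⊢_⇒_) s t

  Lang : Set₁
  Lang = GTerm A → Set

  Desc : TRS A → Lang → Lang
  Desc R L p = ∃ λ q → L q × (R ⊢ q ⇒* p)

-- Bottom-up tree automata.  States Fin states are treated as constants:
-- configurations are terms Term A (Fin states).

record BTA (A : RankedAlphabet) : Set where
  field
    states : ℕ
    final  : List (Fin states)
    δrules : List (Σ (Fin (size A)) λ f → Vec (Fin states) (rank A f) × Fin states)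
    εrules : List (Fin states × Fin states)

open BTA public

module _ {A : RankedAlphabet} where

  mapVec : {X Y : Set} {k : ℕ} → (X → Y) → Vec X k → Vec Y k
  mapVec g []       = []
  mapVec g (x ∷ xs) = g x ∷ mapVec g xs

  data BTARoot (C : BTA A) : Term A (Fin (states C)) → Term A (Fin (states C)) → Set where
    δ : ∀ {f as a} → (f , as , a) ∈ δrules C → BTARoot C (node f (mapVec var as)) (var a)
    ε : ∀ {a a'} → (a , a') ∈ εrules C → BTARoot C (var a) (var a')

  BTAStep : (C : BTA A) → Term A (Fin (states C)) → Term A (Fin (states C)) → Set
  BTAStep C = InCtx (BTARoot C)

  embed : {V : Set} → GTerm A → Term A V
  embed = subst (λ ())

  Accepts : (C : BTA A) → Lang
  Accepts C t = ∃ λ q → q ∈ final C × Star (BTAStep C) (embed t) (var q)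

  _Recognizes_ : BTA A → Lang → Set
  C Recognizes L = ∀ t → Accepts C t ⇔ L t

  Recognizable : Lang → Set
  Recognizable L = Σ (BTA A) λ C → C Recognizes L

  IsPΣR : TRS A → Set₁
  IsPΣR R = (L : Lang) → Recognizable L → Recognizable (Desc R L)

  -- EPΣRF-TRS: a construction (Agda function, hence effective) mapping each
  -- finite L (given as a list) to a bta recognizing R*(L)
  IsEPΣRF : TRS A → Set
  IsEPΣRF R = Σ (List (GTerm A) → BTA A) λ build →
                ∀ (L : List (GTerm A)) → build L Recognizes Desc R (λ t → t ∈ L)

module Submission where

-- Take Σ = {a/0, f/1, g/2} and the single rule  f(x) → g(x, x).
--
-- R ⊢ s ⇒* t holds iff s ↝ t, where ↝ is the structural relation
-- in which an f-node may be replaced by a g-node whose two children are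
-- independent descendants of the argument.  Since ↝ only looks at subterms of s,
-- the descendants of a finite language L are recognized by the bta whose states
-- are the subterms of L, state u accepting exactly the descendants of u.  Hence R
-- is EPΣRF.
--
-- L₀ = {fⁿ(a)} is recognizable, and g(tᵢ, tⱼ) is a descendant
-- of L₀ (tₖ the full binary g-tree of height k) iff i = j: descendants of fⁿ(a)
-- are "balanced of height n".  A bta for R*(L₀) with N states accepts
-- g(tₖ, tₖ) for k = 0 … N; two of these runs give the same state to the second
-- argument, and exchanging those subruns makes it accept some g(tᵢ, tⱼ) with i ≠ j.

open import Defs
open import Data.Product using (Σ; _×_; _,_; proj₁; proj₂)
open import Data.Sum using (_⊎_; inj₁; inj₂)
open import Data.Empty using (⊥; ⊥-elim)
open import Data.Nat using (ℕ; zero; suc; z≤n; s≤s)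
open import Data.Nat.Properties using (n<1+n; <⇒≢)
open import Data.Fin using (Fin; zero; suc; toℕ)
open import Data.Fin.Properties using (pigeonhole) renaming (_≟_ to _≟ᶠ_)
open import Data.Vec using (Vec; []; _∷_)
open import Data.Vec.Relation.Binary.Pointwise.Inductive using (Pointwise; []; _∷_)
  renaming (refl to pointwise-refl)
open import Data.List
  using (List; []; _∷_; _++_; length; lookup; filter; concatMap; allFin; cartesianProductWith)
open import Data.List.Membership.Propositional using (_∈_; lose)
open import Data.List.Membership.Propositional.Properties
  using (∈-++⁺ˡ; ∈-++⁺ʳ; ∈-++⁻; ∈-filter⁺; ∈-filter⁻; ∈-lookup; ∈-allFin;
         ∈-concatMap⁺; ∈-cartesianProductWith⁺)
import Data.List.Membership.DecPropositional as DecMembership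
open import Data.List.Relation.Unary.Any using (here; there; index)
open import Data.List.Relation.Unary.Any.Properties using (lookup-index)
open import Data.List.Relation.Unary.All using () renaming ([] to []ᴬ; _∷_ to _∷ᴬ_)
open import Data.List.Relation.Unary.AllPairs using () renaming ([] to []ᴾ; _∷_ to _∷ᴾ_)
open import Function.Bundles using (mk⇔; Equivalence)
open import Relation.Nullary using (¬_; Dec; yes; no)
open import Relation.Nullary.Decidable using (_×-dec_; _⊎-dec_)
open import Relation.Binary.Definitions using (DecidableEquality)
open import Relation.Binary.PropositionalEquality using (_≡_; refl; sym; trans; cong; cong₂)
  renaming (subst to transport)
open import Relation.Binary.Construct.Closure.ReflexiveTransitive using (Star; ε; _◅_; _◅◅_; gmap)

module Contexts {A : RankedAlphabet} {V : Set} (ρ : Term A V → Term A V → Set) where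

  Steps : Term A V → Term A V → Set
  Steps = Star (InCtx ρ)

  pointwise-steps : ∀ {k} {ts us : Vec (Term A V) k} →
                    Pointwise Steps ts us → Star (InCtxV ρ) ts us
  pointwise-steps [] = ε
  pointwise-steps {ts = _ ∷ ts} {us = u ∷ _} (p ∷ ps) =
    gmap (_∷ ts) here p ◅◅ gmap (u ∷_) there (pointwise-steps ps)

  lift-args : ∀ {f ts us} → Pointwise Steps ts us → Steps (node f ts) (node f us)
  lift-args {f} ps = gmap (node f) arg (pointwise-steps ps)

  step-pointwise : ∀ {k} {ts us vs : Vec (Term A V) k} →
                   InCtxV ρ ts us → Pointwise Steps us vs → Pointwise Steps ts vs
  step-pointwise (here s)  (p ∷ ps) = (s ◅ p) ∷ ps
  step-pointwise (there s) (p ∷ ps) = p ∷ step-pointwise s ps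

module TermEquality {A : RankedAlphabet} {V : Set} (_≟ⱽ_ : DecidableEquality V) where
  mutual
    _≟ᵀ_ : DecidableEquality (Term A V)
    var x ≟ᵀ var y with x ≟ⱽ y
    ... | yes refl = yes refl
    ... | no x≢y   = no λ { refl → x≢y refl }
    var _ ≟ᵀ node _ _ = no λ ()
    node _ _ ≟ᵀ var _ = no λ ()
    node f ts ≟ᵀ node h us with f ≟ᶠ h
    ... | no f≢h = no λ { refl → f≢h refl }
    ... | yes refl with ts ≟ᵛ us
    ...   | yes refl  = yes refl
    ...   | no ts≢us  = no λ { refl → ts≢us refl }

    _≟ᵛ_ : ∀ {k} → DecidableEquality (Vec (Term A V) k)
    [] ≟ᵛ [] = yes refl
    (t ∷ ts) ≟ᵛ (u ∷ us) with t ≟ᵀ u | ts ≟ᵛ us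
    ... | yes refl | yes refl = yes refl
    ... | no t≢u   | _        = no λ { refl → t≢u refl }
    ... | _        | no ts≢us = no λ { refl → ts≢us refl }

module Runs {A : RankedAlphabet} (C : BTA A) where

  State : Set
  State = Fin (states C)

  Run : Term A State → Term A State → Set
  Run = Star (BTAStep C)

  open Contexts (BTARoot C) using (lift-args; step-pointwise)

  record NodeRun (f : Sym A) (ts : Vec (Term A State) (rank A f)) (q : State) : Set where
    constructor nodeRun
    field
      argStates  : Vec State (rank A f)
      argRuns    : Pointwise Run ts (mapVec {A = A} var argStates)
      target     : State
      transition : (f , argStates , target) ∈ δrules C
      εRun       : Run (var target) (var q)

  -- Every run of a node to a state has this shape: only a δ-rule consumes a symbol.
  decompose : ∀ {f ts q} → Run (node f ts) (var q) → NodeRun f ts q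
  decompose (root (δ m) ◅ rest) = nodeRun _ (pointwise-refl ε) _ m rest
  decompose (arg s ◅ rest) with decompose rest
  ... | nodeRun as runs r m εrun = nodeRun as (step-pointwise s runs) r m εrun

  compose : ∀ {f ts q} → NodeRun f ts q → Run (node f ts) (var q)
  compose (nodeRun _ runs _ m εrun) = lift-args runs ◅◅ root (δ m) ◅ εrun

  ε-free-run : (∀ {p p'} → ¬ (p , p') ∈ εrules C) → ∀ {p q} → Run (var p) (var q) → p ≡ q
  ε-free-run no-ε ε                = refl
  ε-free-run no-ε (root (ε m) ◅ _) = ⊥-elim (no-ε m)

vectorsOver : {X : Set} → List X → (k : ℕ) → List (Vec X k)
vectorsOver xs zero    = [] ∷ []
vectorsOver xs (suc k) = cartesianProductWith _∷_ xs (vectorsOver xs k)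

∈-vectorsOver : {X : Set} {xs : List X} → (∀ x → x ∈ xs) →
                ∀ {k} (v : Vec X k) → v ∈ vectorsOver xs k
∈-vectorsOver all-in []      = here refl
∈-vectorsOver all-in (x ∷ v) = ∈-cartesianProductWith⁺ _∷_ (all-in x) (∈-vectorsOver all-in v)

Transition : RankedAlphabet → ℕ → Set
Transition A n = Σ (Sym A) λ f → Vec (Fin n) (rank A f) × Fin n

transitionsOf : (A : RankedAlphabet) (n : ℕ) (f : Sym A) → List (Transition A n)
transitionsOf A n f =
  cartesianProductWith (λ as r → f , as , r) (vectorsOver (allFin n) (rank A f)) (allFin n)

allTransitions : (A : RankedAlphabet) (n : ℕ) → List (Transition A n)
allTransitions A n = concatMap (transitionsOf A n) (allFin (size A))

∈-allTransitions : ∀ {A n} (τ : Transition A n) → τ ∈ allTransitions A n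
∈-allTransitions {A} {n} (f , as , r) = ∈-concatMap⁺ (transitionsOf A n) (lose (∈-allFin f)
  (∈-cartesianProductWith⁺ _ (∈-vectorsOver ∈-allFin as) (∈-allFin r)))

rank₃ : Fin 3 → ℕ
rank₃ zero             = 0
rank₃ (suc zero)       = 1
rank₃ (suc (suc zero)) = 2

Σ₃ : RankedAlphabet
Σ₃ = record { size = 3 ; rank = rank₃ }

pattern a₀     = node zero []
pattern f₁ x   = node (suc zero) (x ∷ [])
pattern g₂ x y = node (suc (suc zero)) (x ∷ y ∷ [])

Tm : Set
Tm = GTerm Σ₃

duplicate : Rule Σ₃
duplicate = f₁ (var 0) ⟶ g₂ (var 0) (var 0)

duplicate-vars : ∀ x → x ∈ vars (rhs duplicate) → x ∈ vars (lhs duplicate)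
duplicate-vars x (here refl)         = here refl
duplicate-vars x (there (here refl)) = here refl

R : TRS Σ₃
R = record { rules = duplicate ∷ [] ; varCond = duplicate-vars ∷ᴬ []ᴬ }

R-leftLinear : LeftLinear R
R-leftLinear = ([]ᴬ ∷ᴾ []ᴾ) ∷ᴬ []ᴬ

R-monadic : Monadic R
R-monadic = (s≤s z≤n , s≤s z≤n) ∷ᴬ []ᴬ

data _↝_ : Tm → Tm → Set where
  a↝a : a₀ ↝ a₀
  f↝f : ∀ {s t} → s ↝ t → f₁ s ↝ f₁ t
  f↝g : ∀ {s t₁ t₂} → s ↝ t₁ → s ↝ t₂ → f₁ s ↝ g₂ t₁ t₂
  g↝g : ∀ {s₁ s₂ t₁ t₂} → s₁ ↝ t₁ → s₂ ↝ t₂ → g₂ s₁ s₂ ↝ g₂ t₁ t₂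

↝-refl : ∀ s → s ↝ s
↝-refl a₀       = a↝a
↝-refl (f₁ s)   = f↝f (↝-refl s)
↝-refl (g₂ s u) = g↝g (↝-refl s) (↝-refl u)

root-step : ∀ {s t} → RootStep R s t → Σ Tm λ x → s ≡ f₁ x × t ≡ g₂ x x
root-step (apply (here refl) σ) = σ 0 , refl , refl

↝-step : ∀ {s t t'} → s ↝ t → R ⊢ t ⇒ t' → s ↝ t'
↝-step d (root st) with root-step st
... | _ , refl , refl = duplicate-root d
  where
  duplicate-root : ∀ {s x} → s ↝ f₁ x → s ↝ g₂ x x
  duplicate-root (f↝f d) = f↝g d d
↝-step (f↝f d)     (arg (here st))              = f↝f (↝-step d st)
↝-step (f↝g d₁ d₂) (arg (here st))              = f↝g (↝-step d₁ st) d₂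
↝-step (f↝g d₁ d₂) (arg (there (here st)))      = f↝g d₁ (↝-step d₂ st)
↝-step (g↝g d₁ d₂) (arg (here st))              = g↝g (↝-step d₁ st) d₂
↝-step (g↝g d₁ d₂) (arg (there (here st)))      = g↝g d₁ (↝-step d₂ st)

open Contexts (RootStep R) using (lift-args)

⇒*→↝ : ∀ {s t} → R ⊢ s ⇒* t → s ↝ t
⇒*→↝ {s} = go (↝-refl s)
  where
  go : ∀ {s t t'} → s ↝ t → R ⊢ t ⇒* t' → s ↝ t'
  go d ε          = d
  go d (st ◅ sts) = go (↝-step d st) sts

↝→⇒* : ∀ {s t} → s ↝ t → R ⊢ s ⇒* t
↝→⇒* a↝a             = ε
↝→⇒* (f↝f d)         = lift-args (↝→⇒* d ∷ [])
↝→⇒* (f↝g {s} d₁ d₂) = root (apply (here refl) (λ _ → s)) ◅ lift-args (↝→⇒* d₁ ∷ ↝→⇒* d₂ ∷ [])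
↝→⇒* (g↝g d₁ d₂)     = lift-args (↝→⇒* d₁ ∷ ↝→⇒* d₂ ∷ [])

_≟_ : DecidableEquality Tm
_≟_ = TermEquality._≟ᵀ_ λ ()

subterms : Tm → List Tm
subterms a₀       = a₀ ∷ []
subterms (f₁ s)   = f₁ s ∷ subterms s
subterms (g₂ s u) = g₂ s u ∷ subterms s ++ subterms u

subterms-self : ∀ t → t ∈ subterms t
subterms-self a₀       = here refl
subterms-self (f₁ s)   = here refl
subterms-self (g₂ s u) = here refl

subterms-trans : ∀ t {x y} → x ∈ subterms t → y ∈ subterms x → y ∈ subterms t
subterms-trans a₀       (here refl) y∈x = y∈x
subterms-trans (f₁ s)   (here refl) y∈x = y∈x
subterms-trans (f₁ s)   (there x∈s) y∈x = there (subterms-trans s x∈s y∈x)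
subterms-trans (g₂ s u) (here refl) y∈x = y∈x
subterms-trans (g₂ s u) (there x∈su) y∈x with ∈-++⁻ (subterms s) x∈su
... | inj₁ x∈s = there (∈-++⁺ˡ (subterms-trans s x∈s y∈x))
... | inj₂ x∈u = there (∈-++⁺ʳ (subterms s) (subterms-trans u x∈u y∈x))

Subterms : List Tm → List Tm
Subterms []      = []
Subterms (l ∷ L) = subterms l ++ Subterms L

Subterms-closed : ∀ L {x y} → x ∈ Subterms L → y ∈ subterms x → y ∈ Subterms L
Subterms-closed (l ∷ L) x∈ y∈x with ∈-++⁻ (subterms l) x∈
... | inj₁ x∈l = ∈-++⁺ˡ (subterms-trans l x∈l y∈x)
... | inj₂ x∈L = ∈-++⁺ʳ (subterms l) (Subterms-closed L x∈L y∈x)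

Subterms-⊇ : ∀ L {l} → l ∈ L → l ∈ Subterms L
Subterms-⊇ (l ∷ L) (here refl) = ∈-++⁺ˡ (subterms-self l)
Subterms-⊇ (l ∷ L) (there l∈L) = ∈-++⁺ʳ (subterms l) (Subterms-⊇ L l∈L)

-- The bta recognizing R*(L) for a finite L: state k stands for the subterm ⟦ k ⟧ of L
-- and, as the invariant of `sound` and `complete`, accepts exactly its descendants.
module DescendantAutomaton (L : List Tm) where

  n : ℕ
  n = length (Subterms L)

  ⟦_⟧ : Fin n → Tm
  ⟦_⟧ = lookup (Subterms L)

  state-of : ∀ {x} → x ∈ Subterms L → Σ (Fin n) λ k → ⟦ k ⟧ ≡ x
  state-of x∈ = index x∈ , sym (lookup-index x∈)

  substate : ∀ k {x y} → ⟦ k ⟧ ≡ x → y ∈ subterms x → Σ (Fin n) λ i → ⟦ i ⟧ ≡ y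
  substate k refl y∈ = state-of (Subterms-closed L (∈-lookup k) y∈)

  -- The transitions mirror the constructors of ↝.
  Admitted : Transition Σ₃ n → Set
  Admitted (zero , [] , k)                 = ⟦ k ⟧ ≡ a₀
  Admitted (suc zero , i ∷ [] , k)         = ⟦ k ⟧ ≡ f₁ ⟦ i ⟧
  Admitted (suc (suc zero) , i ∷ j ∷ [] , k) =
    (⟦ k ⟧ ≡ g₂ ⟦ i ⟧ ⟦ j ⟧) ⊎ (⟦ i ⟧ ≡ ⟦ j ⟧ × ⟦ k ⟧ ≡ f₁ ⟦ i ⟧)

  admitted? : (τ : Transition Σ₃ n) → Dec (Admitted τ)
  admitted? (zero , [] , k)                 = ⟦ k ⟧ ≟ a₀
  admitted? (suc zero , i ∷ [] , k)         = ⟦ k ⟧ ≟ f₁ ⟦ i ⟧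
  admitted? (suc (suc zero) , i ∷ j ∷ [] , k) =
    (⟦ k ⟧ ≟ g₂ ⟦ i ⟧ ⟦ j ⟧) ⊎-dec ((⟦ i ⟧ ≟ ⟦ j ⟧) ×-dec (⟦ k ⟧ ≟ f₁ ⟦ i ⟧))

  open DecMembership _≟_ using (_∈?_)

  automaton : BTA Σ₃
  automaton = record
    { states = n
    ; final  = filter (λ k → ⟦ k ⟧ ∈? L) (allFin n)
    ; δrules = filter admitted? (allTransitions Σ₃ n)
    ; εrules = [] }

  open Runs automaton using (Run; nodeRun; decompose; compose; ε-free-run)

  admitted : ∀ {τ} → τ ∈ δrules automaton → Admitted τ
  admitted τ∈ = proj₂ (∈-filter⁻ admitted? {xs = allTransitions Σ₃ n} τ∈)

  transition : ∀ {τ} → Admitted τ → τ ∈ δrules automaton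
  transition {τ} adm = ∈-filter⁺ admitted? (∈-allTransitions τ) adm

  no-move : ∀ {p q} → Run (var p) (var q) → p ≡ q
  no-move = ε-free-run λ ()

  sound : ∀ t {k} → Run (embed t) (var k) → ⟦ k ⟧ ↝ t
  sound a₀ run with decompose run
  ... | nodeRun [] [] _ m rest with no-move rest
  ...   | refl = transport (_↝ a₀) (sym (admitted m)) a↝a
  sound (f₁ u) run with decompose run
  ... | nodeRun (i ∷ []) (r ∷ []) _ m rest with no-move rest
  ...   | refl = transport (_↝ f₁ u) (sym (admitted m)) (f↝f (sound u r))
  sound (g₂ u w) run with decompose run
  ... | nodeRun (i ∷ j ∷ []) (r₁ ∷ r₂ ∷ []) _ m rest with no-move rest | admitted m
  ...   | refl | inj₁ k≡g = transport (_↝ g₂ u w) (sym k≡g) (g↝g (sound u r₁) (sound w r₂))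
  ...   | refl | inj₂ (i≡j , k≡f) = transport (_↝ g₂ u w) (sym k≡f)
          (f↝g (sound u r₁) (transport (_↝ w) (sym i≡j) (sound w r₂)))

  fire : ∀ {f ts} as k → Pointwise Run ts (mapVec {A = Σ₃} var as) →
         Admitted (f , as , k) → Run (node f ts) (var k)
  fire as k runs adm = compose (nodeRun as runs k (transition adm) ε)

  complete : ∀ {s t} → s ↝ t → ∀ k → ⟦ k ⟧ ≡ s → Run (embed t) (var k)
  complete a↝a k k≡a = fire [] k [] k≡a
  complete (f↝f {s} d) k k≡f with substate k k≡f (there (subterms-self s))
  ... | i , i≡s = fire (i ∷ []) k (complete d i i≡s ∷ []) (trans k≡f (cong f₁ (sym i≡s)))
  complete (f↝g {s} d₁ d₂) k k≡f with substate k k≡f (there (subterms-self s))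
  ... | i , i≡s = fire (i ∷ i ∷ []) k (complete d₁ i i≡s ∷ complete d₂ i i≡s ∷ [])
                       (inj₂ (refl , trans k≡f (cong f₁ (sym i≡s))))
  complete (g↝g {s₁} {s₂} d₁ d₂) k k≡g
    with substate k k≡g (there (∈-++⁺ˡ (subterms-self s₁)))
       | substate k k≡g (there (∈-++⁺ʳ (subterms s₁) (subterms-self s₂)))
  ... | i , i≡s₁ | j , j≡s₂ = fire (i ∷ j ∷ []) k (complete d₁ i i≡s₁ ∷ complete d₂ j j≡s₂ ∷ [])
                                   (inj₁ (trans k≡g (cong₂ g₂ (sym i≡s₁) (sym j≡s₂))))

  recognizes : automaton Recognizes Desc R (_∈ L)
  recognizes t = mk⇔ accepted→desc desc→accepted
    where
    accepted→desc : Accepts automaton t → Desc R (_∈ L) t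
    accepted→desc (k , k-final , run) =
      ⟦ k ⟧ , proj₂ (∈-filter⁻ (λ k → ⟦ k ⟧ ∈? L) {xs = allFin n} k-final) , ↝→⇒* (sound t run)
    desc→accepted : Desc R (_∈ L) t → Accepts automaton t
    desc→accepted (l , l∈L , steps) with state-of (Subterms-⊇ L l∈L)
    ... | k , k≡l = k , ∈-filter⁺ (λ k → ⟦ k ⟧ ∈? L) (∈-allFin k) (transport (_∈ L) (sym k≡l) l∈L)
                      , complete (⇒*→↝ steps) k k≡l

R-EPΣRF : IsEPΣRF R
R-EPΣRF = DescendantAutomaton.automaton , DescendantAutomaton.recognizes

data Balanced : ℕ → Tm → Set where
  a-bal : Balanced 0 a₀
  f-bal : ∀ {n s} → Balanced n s → Balanced (suc n) (f₁ s)
  g-bal : ∀ {n s u} → Balanced n s → Balanced n u → Balanced (suc n) (g₂ s u)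

↝-balanced : ∀ {n s t} → Balanced n s → s ↝ t → Balanced n t
↝-balanced a-bal         a↝a         = a-bal
↝-balanced (f-bal b)     (f↝f d)     = f-bal (↝-balanced b d)
↝-balanced (f-bal b)     (f↝g d₁ d₂) = g-bal (↝-balanced b d₁) (↝-balanced b d₂)
↝-balanced (g-bal b₁ b₂) (g↝g d₁ d₂) = g-bal (↝-balanced b₁ d₁) (↝-balanced b₂ d₂)

L₀-automaton : BTA Σ₃
L₀-automaton = record
  { states = 1 ; final = zero ∷ []
  ; δrules = (zero , [] , zero) ∷ (suc zero , zero ∷ [] , zero) ∷ []
  ; εrules = [] }

L₀ : Tm → Set
L₀ = Accepts L₀-automaton

L₀-recognizable : Recognizable L₀
L₀-recognizable = L₀-automaton , λ t → mk⇔ (λ acc → acc) (λ acc → acc)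

fⁿa : ℕ → Tm
fⁿa zero    = a₀
fⁿa (suc n) = f₁ (fⁿa n)

full : ℕ → Tm
full zero    = a₀
full (suc n) = g₂ (full n) (full n)

module L₀-runs = Runs L₀-automaton

fⁿa∈L₀ : ∀ n → L₀-runs.Run (embed (fⁿa n)) (var zero)
fⁿa∈L₀ zero    = L₀-runs.compose (L₀-runs.nodeRun [] [] zero (here refl) ε)
fⁿa∈L₀ (suc n) = L₀-runs.compose (L₀-runs.nodeRun (zero ∷ []) (fⁿa∈L₀ n ∷ []) zero (there (here refl)) ε)

L₀-balanced : ∀ t {q} → L₀-runs.Run (embed t) (var q) → Σ ℕ λ n → Balanced n t
L₀-balanced a₀ _ = 0 , a-bal
L₀-balanced (f₁ u) run with L₀-runs.decompose run
... | L₀-runs.nodeRun (_ ∷ []) (r ∷ []) _ _ _ with L₀-balanced u r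
...   | n , b = suc n , f-bal b
L₀-balanced (g₂ u w) run with L₀-runs.decompose run
... | L₀-runs.nodeRun _ _ _ (there (there ())) _

fⁿa↝full : ∀ n → fⁿa n ↝ full n
fⁿa↝full zero    = a↝a
fⁿa↝full (suc n) = f↝g (fⁿa↝full n) (fⁿa↝full n)

full-height : ∀ {n} i → Balanced n (full i) → n ≡ i
full-height zero    a-bal       = refl
full-height (suc i) (g-bal b _) = cong suc (full-height i b)

full-pair∈R*L₀ : ∀ i → Desc R L₀ (g₂ (full i) (full i))
full-pair∈R*L₀ i = fⁿa (suc i) , (zero , here refl , fⁿa∈L₀ (suc i)) , ↝→⇒* (fⁿa↝full (suc i))

full-pair∉R*L₀ : ∀ {i j} → ¬ i ≡ j → ¬ Desc R L₀ (g₂ (full i) (full j))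
full-pair∉R*L₀ {i} {j} i≢j (s , (_ , _ , run) , steps) with L₀-balanced s run
... | n , b with ↝-balanced b (⇒*→↝ steps)
...   | g-bal bᵢ bⱼ = i≢j (trans (sym (full-height i bᵢ)) (full-height j bⱼ))

module NoAutomatonFor-R*L₀ (C : BTA Σ₃) (recognizes : C Recognizes Desc R L₀) where
  open Runs C using (State; Run; NodeRun; nodeRun; decompose; compose)

  accepting : ∀ k → Accepts C (g₂ (full k) (full k))
  accepting k = Equivalence.from (recognizes _) (full-pair∈R*L₀ k)

  split : ∀ k → NodeRun (suc (suc zero)) (embed (full k) ∷ embed (full k) ∷ []) (proj₁ (accepting k))
  split k = decompose (proj₂ (proj₂ (accepting k)))

  second : ∀ {x y q} → NodeRun (suc (suc zero)) (x ∷ y ∷ []) q → State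
  second (nodeRun (_ ∷ p ∷ []) _ _ _ _) = p

  graft : ∀ {x y y' q} (r : NodeRun (suc (suc zero)) (x ∷ y ∷ []) q) →
          Run y' (var (second r)) → Run (g₂ x y') (var q)
  graft (nodeRun (p₁ ∷ p₂ ∷ []) (r₁ ∷ _ ∷ []) t m εrun) run' =
    compose (nodeRun (p₁ ∷ p₂ ∷ []) (r₁ ∷ run' ∷ []) t m εrun)

  second-run : ∀ {x y q} (r : NodeRun (suc (suc zero)) (x ∷ y ∷ []) q) → Run y (var (second r))
  second-run (nodeRun (_ ∷ _ ∷ []) (_ ∷ r₂ ∷ []) _ _ _) = r₂

  crossed : ∀ i j → second (split i) ≡ second (split j) → Desc R L₀ (g₂ (full i) (full j))
  crossed i j same = Equivalence.to (recognizes _)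
    (proj₁ (accepting i) , proj₁ (proj₂ (accepting i)) ,
     graft (split i) (transport (λ p → Run (embed (full j)) (var p)) (sym same) (second-run (split j))))

  contradiction : ⊥
  contradiction with pigeonhole (n<1+n (states C)) (λ x → second (split (toℕ x)))
  ... | i , j , i<j , same = full-pair∉R*L₀ (<⇒≢ i<j) (crossed (toℕ i) (toℕ j) same)

R-not-PΣR : ¬ IsPΣR R
R-not-PΣR preserves with preserves L₀ L₀-recognizable
... | C , recognizes = NoAutomatonFor-R*L₀.contradiction C recognizes

mainTheorem12 : Σ RankedAlphabet λ A → Σ (TRS A) λ R →
    LeftLinear R × Monadic R × IsEPΣRF R × ¬ IsPΣR R
mainTheorem12 = Σ₃ , R , R-leftLinear , R-monadic , R-EPΣRF , R-not-PΣR
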